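{- Let $G$ be a graph. For every pair of edges $xy, uv\in E(G)$, we have $S_{xy}=S_{uv}$ if and only if $xy\in S_{uv}$.
   Context: For $e\in E(G)$, let $\mathcal{S}_e$ be the family of all sets $S\subseteq E(G)$ such that $e\in S$ and, for every edge $d\notin S$, there is no induced copy of $P_3$ in $G$ consisting of $d$ and an edge of $S$. $S_e$ denotes the member of $\mathcal{S}_e$ of minimum cardinality (it is unique; equivalently it is the intersection of all members of $\mathcal{S}_e$). -}

module Defs where

open import Data.Nat using (ℕ)
open import Data.Fin using (Fin; _<_)
open import Data.Bool using (Bool; true; false; T)
open import Data.Product using (Σ; ∃; _×_; _,_)
open import Data.Sum using (_⊎_)
open import Relation.Nullary using (¬_)
open import Relation.Binary.PropositionalEquality using (_≡_; _≢_)

record Graph : Set where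
  field
    n     : ℕ
    adj   : Fin n → Fin n → Bool
    sym   : ∀ x y → adj x y ≡ adj y x
    irref : ∀ x → adj x x ≡ false

open Graph public

Adj : (G : Graph) → Fin (n G) → Fin (n G) → Set
Adj G x y = T (adj G x y)

-- An edge {x,y}, stored canonically with x < y.
record Edge (G : Graph) : Set where
  constructor edge
  field
    x   : Fin (n G)
    y   : Fin (n G)
    x<y : x < y
    xy  : Adj G x y

open Edge public

_HasEnds_,_ : ∀ {G} → Edge G → Fin (n G) → Fin (n G) → Set
d HasEnds a , b = (x d ≡ a × y d ≡ b) ⊎ (x d ≡ b × y d ≡ a)

InducedP3 : ∀ {G} → Edge G → Edge G → Set
InducedP3 {G} d e =
  Σ (Fin (n G)) λ a → Σ (Fin (n G)) λ w → Σ (Fin (n G)) λ b →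
    (d HasEnds a , w) × (e HasEnds w , b) × a ≢ b × ¬ Adj G a b

EdgeSet : Graph → Set
EdgeSet G = Edge G → Bool

_∈ₛ_ : ∀ {G} → Edge G → EdgeSet G → Set
d ∈ₛ S = S d ≡ true

_∉ₛ_ : ∀ {G} → Edge G → EdgeSet G → Set
d ∉ₛ S = S d ≡ false

-- S ∈ 𝒮_e : e ∈ S and no edge outside S forms an induced P₃ with an edge of S.
InFamily : ∀ {G} → Edge G → EdgeSet G → Set
InFamily {G} e S =
  e ∈ₛ S × (∀ (d f : Edge G) → d ∉ₛ S → f ∈ₛ S → ¬ InducedP3 d f)

-- Membership in S_e, the intersection of all members of 𝒮_e.
_∈S[_] : ∀ {G} → Edge G → Edge G → Set
_∈S[_] {G} d e = ∀ (S : EdgeSet G) → InFamily e S → d ∈ₛ S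

-- The induced-P₃ relation is symmetric, so the complement of any S ∈ 𝒮_e
-- omitting f belongs to 𝒮_f. Hence e ∈ S_f forces f ∈ S_e: membership is
-- symmetric. It is also transitive, since a member of 𝒮_f containing e is a
-- member of 𝒮_e. The theorem follows: S_e = S_f gives e ∈ S_e = S_f, and
-- conversely e ∈ S_f and f ∈ S_e make each of S_e, S_f contained in the other.
module Submission where

open import Defs
open import Data.Bool using (T; true; false; not)
open import Data.Bool.Properties using (not-injective)
open import Data.Product using (_,_; proj₁)
open import Data.Sum using (inj₁; inj₂)
open import Function using (_∘_)
open import Function.Bundles using (_⇔_; mk⇔; Equivalence)
open import Relation.Nullary using (contradiction)
open import Relation.Binary.PropositionalEquality
  using (refl; trans; cong; subst; ≢-sym) renaming (sym to ≡-sym)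

HasEnds-swap : ∀ {G} {d : Edge G} {a b} → d HasEnds a , b → d HasEnds b , a
HasEnds-swap (inj₁ ends) = inj₂ ends
HasEnds-swap (inj₂ ends) = inj₁ ends

InducedP3-sym : ∀ {G} {d e : Edge G} → InducedP3 d e → InducedP3 e d
InducedP3-sym {G} {d} {e} (a , w , b , d-aw , e-wb , a≢b , a≁b) =
  b , w , a , HasEnds-swap {d = e} e-wb , HasEnds-swap {d = d} d-aw ,
  ≢-sym a≢b , a≁b ∘ subst T (Graph.sym G b a)

InFamily-complement : ∀ {G} {e f : Edge G} {S : EdgeSet G} →
  InFamily e S → f ∉ₛ S → InFamily f (not ∘ S)
InFamily-complement (_ , closed) f∉S =
  cong not f∉S ,
  λ d g d∉Sᶜ g∈Sᶜ p3 →
    closed g d (not-injective g∈Sᶜ) (not-injective d∉Sᶜ) (InducedP3-sym {d = d} {g} p3)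

∈S-refl : ∀ {G} {e : Edge G} → e ∈S[ e ]
∈S-refl S = proj₁

∈S-sym : ∀ {G} {e f : Edge G} → e ∈S[ f ] → f ∈S[ e ]
∈S-sym {e = e} {f} e∈Sf S S∈𝒮e@(e∈S , _) with S f in f∈?S
... | true  = refl
... | false = contradiction (trans (≡-sym e∈S) e∉S) λ ()
  where
  e∉S : e ∉ₛ S
  e∉S = not-injective (e∈Sf (not ∘ S) (InFamily-complement S∈𝒮e f∈?S))

∈S-trans : ∀ {G} {d e f : Edge G} → d ∈S[ e ] → e ∈S[ f ] → d ∈S[ f ]
∈S-trans d∈Se e∈Sf S S∈𝒮f@(_ , closed) = d∈Se S (e∈Sf S S∈𝒮f , closed)

theorem6 : (G : Graph) (e f : Edge G) →
    ((∀ (d : Edge G) → (d ∈S[ e ]) ⇔ (d ∈S[ f ])) ⇔ (e ∈S[ f ]))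
theorem6 G e f = mk⇔
  (λ Se=Sf → Equivalence.to (Se=Sf e) ∈S-refl)
  (λ e∈Sf d → mk⇔ (λ d∈Se → ∈S-trans d∈Se e∈Sf)
                  (λ d∈Sf → ∈S-trans d∈Sf (∈S-sym e∈Sf)))
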